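{- Let $(f_n)$ be a family of polynomials over a field $\mathbb{F}$ that is computed by a family of stack branching programs of size polynomial in $n$. Then $(f_n)\in\mathsf{VP}$.
   Context: $\mathsf{VP}$ is the class of polynomial families of degree polynomially bounded in $n$ computed by arithmetic circuits (DAGs with input gates labeled by field constants or variables and fanin-2 $+$/$\times$ gates, size = number of gates) of size polynomial in $n$. Stack branching programs (SBPs): Let $S$ be a finite symbol set. Stack operations are $\mathrm{push}(s)$, $\mathrm{pop}(s)$ for $s\in S$, and $\mathrm{nop}$. Realizable sequences are defined inductively: the empty sequence is realizable; if $P$ is realizable then $\mathrm{push}(s)P\,\mathrm{pop}(s)$, $\mathrm{nop}\,P$ and $P\,\mathrm{nop}$ are realizable; if $P,Q$ are realizable so is $PQ$. An SBP is a DAG with distinguished vertices $s,t$, an edge weight labeling $w:E\to\mathbb{F}\cup\{X_1,X_2,\dots\}$ and an edge labeling $\sigma$ by stack operations. A path is stack-realizable if its sequence of edge operations is realizable; its weight is the product of its edge weights. The SBP computes $\sum_P w(P)$ over stack-realizable $s$-$t$-paths. Size = number of vertices. -}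

module Defs where

open import Level using (Level; _⊔_)
open import Algebra.Bundles using (CommutativeRing)
open import Data.Nat using (ℕ; zero; suc; _≤_; _<_)
import Data.Nat as N
open import Data.Fin using (Fin; toℕ)
open import Data.List using (List; []; _∷_)
open import Data.List.Membership.Propositional using (_∈_)
open import Data.List.Relation.Unary.Unique.Propositional using (Unique)
open import Data.Maybe using (Maybe; just; nothing)
open import Data.Product using (Σ; ∃; _×_; _,_)
open import Relation.Nullary using (¬_)
open import Function.Bundles using (_⇔_)
open import Relation.Binary.PropositionalEquality using (_≡_)
import Data.List
import Data.Product

record IsField {c ℓ : Level} (R : CommutativeRing c ℓ) : Set (c Level.⊔ ℓ) where
  open CommutativeRing R using (Carrier; _≈_; _*_; 0#; 1#)
  field
    1≉0     : ¬ (1# ≈ 0#)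
    inverse : ∀ x → ¬ (x ≈ 0#) → Σ Carrier (λ y → (x * y) ≈ 1#)

module Over {c ℓ : Level} (R : CommutativeRing c ℓ) where
  open CommutativeRing R using (0#; 1#) renaming (Carrier to F; _≈_ to _≈F_; _+_ to _+F_; _*_ to _*F_; -_ to -F_)

  -- Polynomials in the variables X_0, X_1, ... over F:
  -- expressions modulo the commutative-ring congruence (free commutative
  -- F-algebra on countably many variables = F[X_0, X_1, ...]).

  data Poly : Set c where
    con  : F → Poly
    var  : ℕ → Poly
    _⊕_  : Poly → Poly → Poly
    _⊗_  : Poly → Poly → Poly

  infixl 6 _⊕_
  infixl 7 _⊗_
  infix 4 _≈P_

  data _≈P_ : Poly → Poly → Set (c Level.⊔ ℓ) where
    refl≈  : ∀ {p} → p ≈P p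
    sym≈   : ∀ {p q} → p ≈P q → q ≈P p
    trans≈ : ∀ {p q r} → p ≈P q → q ≈P r → p ≈P r
    ⊕-cong : ∀ {p p' q q'} → p ≈P p' → q ≈P q' → p ⊕ q ≈P p' ⊕ q'
    ⊗-cong : ∀ {p p' q q'} → p ≈P p' → q ≈P q' → p ⊗ q ≈P p' ⊗ q'
    con-cong : ∀ {a b} → a ≈F b → con a ≈P con b
    con-+    : ∀ a b → con (a +F b) ≈P con a ⊕ con b
    con-*    : ∀ a b → con (a *F b) ≈P con a ⊗ con b
    ⊕-assoc  : ∀ p q r → (p ⊕ q) ⊕ r ≈P p ⊕ (q ⊕ r)
    ⊕-comm   : ∀ p q → p ⊕ q ≈P q ⊕ p
    ⊕-idˡ    : ∀ p → con 0# ⊕ p ≈P p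
    ⊕-invʳ   : ∀ p → p ⊕ (con (-F 1#) ⊗ p) ≈P con 0#
    ⊗-assoc  : ∀ p q r → (p ⊗ q) ⊗ r ≈P p ⊗ (q ⊗ r)
    ⊗-comm   : ∀ p q → p ⊗ q ≈P q ⊗ p
    ⊗-idˡ    : ∀ p → con 1# ⊗ p ≈P p
    distribˡ : ∀ p q r → p ⊗ (q ⊕ r) ≈P (p ⊗ q) ⊕ (p ⊗ r)

  sdeg : Poly → ℕ
  sdeg (con _) = 0
  sdeg (var _) = 1
  sdeg (p ⊕ q) = sdeg p N.⊔ sdeg q
  sdeg (p ⊗ q) = sdeg p N.+ sdeg q

  -- the polynomial p has (total) degree at most d: it is represented by
  -- some expression of syntactic degree ≤ d (e.g. its monomial expansion).
  DegreeAtMost : Poly → ℕ → Set (c Level.⊔ ℓ)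
  DegreeAtMost p d = Σ Poly (λ q → (q ≈P p) × (sdeg q ≤ d))

  -- Arithmetic circuits, given as gates in topological order: gate number
  -- i may only read gates with smaller numbers.  Size = number of gates.

  data Gate (i : ℕ) : Set c where
    inConst : F → Gate i
    inVar   : ℕ → Gate i
    add     : Fin i → Fin i → Gate i
    mul     : Fin i → Fin i → Gate i

  data Gates : ℕ → Set c where
    []  : Gates 0
    _▷_ : ∀ {i} → Gates i → Gate i → Gates (suc i)

  open import Data.Vec using (Vec; []; _∷ʳ_; lookup)

  evalGate : ∀ {i} → Vec Poly i → Gate i → Poly
  evalGate vs (inConst a) = con a
  evalGate vs (inVar x)   = var x
  evalGate vs (add j k)   = lookup vs j ⊕ lookup vs k
  evalGate vs (mul j k)   = lookup vs j ⊗ lookup vs k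

  evalGates : ∀ {i} → Gates i → Vec Poly i
  evalGates []      = []
  evalGates (g ▷ x) = let vs = evalGates g in vs ∷ʳ evalGate vs x

  record Circuit : Set c where
    field
      size   : ℕ
      gates  : Gates size
      output : Fin size

  CircuitComputes : Circuit → Poly → Set (c Level.⊔ ℓ)
  CircuitComputes C f = lookup (evalGates (Circuit.gates C)) (Circuit.output C) ≈P f

  data StackOp (k : ℕ) : Set where
    push : Fin k → StackOp k
    pop  : Fin k → StackOp k
    nop  : StackOp k

  data Realizable {k : ℕ} : List (StackOp k) → Set where
    empty   : Realizable []
    wrap    : ∀ {P} (s : Fin k) → Realizable P →
              Realizable (push s ∷ P Data.List.++ (pop s ∷ []))
    nopˡ    : ∀ {P} → Realizable P → Realizable (nop ∷ P)
    nopʳ    : ∀ {P} → Realizable P → Realizable (P Data.List.++ (nop ∷ []))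
    concat  : ∀ {P Q} → Realizable P → Realizable Q → Realizable (P Data.List.++ Q)

  data Weight : Set c where
    wConst : F → Weight
    wVar   : ℕ → Weight

  weightPoly : Weight → Poly
  weightPoly (wConst a) = con a
  weightPoly (wVar x)   = var x

  -- An SBP on vertex set Fin size (size = number of vertices), stack
  -- symbols Fin symbols.  edge u v = just (w , op) means there is an edge
  -- u → v with weight w and stack operation op.  Acyclicity is encoded by
  -- a topological numbering: edges only go from smaller to larger vertices.
  record SBP : Set c where
    field
      size    : ℕ
      symbols : ℕ
      edge    : Fin size → Fin size → Maybe (Weight × StackOp symbols)
      acyclic : ∀ u v w → edge u v ≡ just w → toℕ u < toℕ v
      source  : Fin size
      target  : Fin size

  module _ (B : SBP) where
    open SBP B

    -- a path given by its vertex sequence (first vertex first)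
    data IsPathFrom : Fin size → List (Fin size) → Set c where
      here : IsPathFrom target (target ∷ [])
      step : ∀ {u v vs} (lbl : Weight × StackOp symbols) → edge u v ≡ just lbl →
             IsPathFrom v (v ∷ vs) → IsPathFrom u (u ∷ v ∷ vs)

    -- edge labels along a vertex sequence (meaningful for paths)
    labelsFrom : Fin size → List (Fin size) → List (Weight × StackOp symbols)
    labelsFrom u []       = []
    labelsFrom u (v ∷ vs) with edge u v
    ... | just l  = l ∷ labelsFrom v vs
    ... | nothing = labelsFrom v vs

    labels : List (Fin size) → List (Weight × StackOp symbols)
    labels []       = []
    labels (u ∷ vs) = labelsFrom u vs

    opsOf : List (Fin size) → List (StackOp symbols)
    opsOf p = Data.List.map Data.Product.proj₂ (labels p)

    weightOf : List (Fin size) → Poly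
    weightOf p = Data.List.foldr (λ l acc → weightPoly (Data.Product.proj₁ l) ⊗ acc) (con 1#) (labels p)

    GoodPath : List (Fin size) → Set c
    GoodPath p = IsPathFrom source p × Realizable (opsOf p)

    -- B computes f: f is the sum of the weights of all stack-realizable
    -- s-t paths; the (finite) set of such paths is given by a duplicate-free
    -- list enumerating exactly them.
    SBPComputes : Poly → Set (c Level.⊔ ℓ)
    SBPComputes f =
      Σ (List (List (Fin size))) λ L →
        Unique L ×
        (∀ p → (p ∈ L) ⇔ GoodPath p) ×
        (Data.List.foldr (λ p acc → weightOf p ⊕ acc) (con 0#) L ≈P f)

  PolyBounded : (ℕ → ℕ) → Set
  PolyBounded s = ∃ λ a → ∃ λ k → ∀ n → s n ≤ a N.* n N.^ k N.+ a

  InVP : (ℕ → Poly) → Set (c Level.⊔ ℓ)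
  InVP f =
    (∃ λ (d : ℕ → ℕ) → PolyBounded d × (∀ n → DegreeAtMost (f n) (d n))) ×
    (∃ λ (C : ℕ → Circuit) → PolyBounded (λ n → Circuit.size (C n)) ×
                             (∀ n → CircuitComputes (C n) (f n)))

  ComputedByPolySBPs : (ℕ → Poly) → Set (c Level.⊔ ℓ)
  ComputedByPolySBPs f =
    ∃ λ (B : ℕ → SBP) → PolyBounded (λ n → SBP.size (B n)) ×
                        (∀ n → SBPComputes (B n) (f n))

module Submission where

-- Realizable stack words are exactly the balanced words of the unambiguous grammar
-- D ::= ε | nop D | push s D pop s D.  Read on paths, a canonical u-v path is trivial,
-- a nop edge u → u′ followed by a canonical u′-v path, or a push edge u → u′ matched by
-- a pop edge x → y around canonical paths u′ ⋯ x and y ⋯ v.  `extend` builds the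
-- canonical paths with < k+1 edges from those with < k edges; it is sound, complete
-- and duplicate-free (a word splits uniquely at its first unmatched pop), so the path
-- weight sums obey a recurrence by terms (`template`) of size O(|V|³).  Compiling |V|
-- levels of |V|² templates gives an O(|V|⁶)-size circuit for the sum over all
-- realizable source-target paths; acyclicity bounds their length by |V|, which also
-- bounds the degree.

open import Defs
open import Level using (Level; _⊔_)
open import Algebra.Bundles using (CommutativeRing)
open import Data.Nat using (ℕ; zero; suc; pred; _+_; _*_; _^_; _≤_; _<_; z≤n; s≤s)
open import Data.Nat.Properties
  using ( ≤-refl; ≤-reflexive; ≤-trans; ≤-<-trans; <⇒≤; n≤1+n; m≤m+n; m≤n+m; m≤m*n; ⊔-lub
        ; +-comm; +-assoc; +-suc; +-identityʳ; +-mono-≤; +-monoˡ-≤; +-monoʳ-≤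
        ; *-identityʳ; *-distribʳ-+; *-mono-≤; *-monoʳ-≤
        ; ^-zeroˡ; ^-distribˡ-+-*; ^-monoˡ-≤; ^-monoʳ-≤; m^n>0; module ≤-Reasoning )
open import Data.Nat.Solver using (module +-*-Solver)
open import Data.Fin using (Fin; zero; suc; toℕ; inject₁; fromℕ; combine; remQuot; _≟_)
open import Data.Fin.Properties using (toℕ<n; remQuot-combine)
open import Data.Vec using (Vec; []; _∷_; _∷ʳ_; lookup)
open import Data.List using (List; []; _∷_; _++_; map; concatMap; foldr; length; allFin; cartesianProduct)
open import Data.List.Properties using (++-assoc; ++-cancelˡ; ∷-injective; ∷-injectiveʳ; map-++; length-++; length-map; length-tabulate)
open import Data.List.Membership.Propositional using (_∈_; find; lose)
open import Data.List.Membership.Propositional.Properties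
  using (∈-map⁺; ∈-map⁻; ∈-++⁺ˡ; ∈-++⁺ʳ; ∈-++⁻; ∈-concatMap⁺; ∈-concatMap⁻; ∈-allFin; ∈-cartesianProduct⁺)
open import Data.List.Membership.Propositional.Properties.WithK using (unique∧set⇒bag)
open import Data.List.Relation.Unary.Any using (here; there)
open import Data.List.Relation.Unary.All as All using ([])
open import Data.List.Relation.Unary.AllPairs using ([]; _∷_)
open import Data.List.Relation.Unary.Unique.Propositional using (Unique)
import Data.List.Relation.Unary.Unique.Propositional.Properties as Unique
open import Data.List.Relation.Binary.Disjoint.Propositional using (Disjoint)
open import Data.List.Relation.Binary.Permutation.Propositional as ↭ using (_↭_)
open import Data.List.Relation.Binary.BagAndSetEquality using (∼bag⇒↭)
open import Data.Maybe using (Maybe; just; nothing)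
open import Data.Maybe.Properties using (just-injective)
open import Data.Product using (Σ; ∃; _×_; _,_; proj₁; proj₂; uncurry)
open import Data.Sum using (_⊎_; inj₁; inj₂)
open import Data.Unit using (⊤)
open import Data.Empty using (⊥; ⊥-elim)
open import Function using (_∘_)
open import Function.Bundles using (_⇔_; mk⇔; Equivalence)
open import Relation.Nullary using (yes; no)
open import Relation.Binary.Bundles using (Setoid)
import Relation.Binary.Reasoning.Setoid
open import Relation.Binary.PropositionalEquality using (_≡_; refl; sym; trans; cong; cong₂; subst)


-- The bound  a·nᵏ + a  of Defs (PolyBounded) is
-- equivalent to  g x ≤ a·(x+1)ᵏ  (PolyGrowth), which is closed under sums and
-- products; the circuit size is then bounded by combining these closure lemmas.
module PolynomialGrowth where
  open ≤-Reasoning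
  open +-*-Solver using (solve; _:+_; _:*_; _:=_; con)

  PolyGrowth : (ℕ → ℕ) → Set
  PolyGrowth g = ∃ λ a → ∃ λ k → ∀ x → g x ≤ a * suc x ^ k

  ≤*suc^ : ∀ a x k → a ≤ a * suc x ^ k
  ≤*suc^ a x k = begin
    a                 ≡⟨ sym (*-identityʳ a) ⟩
    a * 1             ≤⟨ *-monoʳ-≤ a (m^n>0 (suc x) k) ⟩
    a * suc x ^ k     ∎

  interchange : ∀ a b c d → (a * b) * (c * d) ≡ (a * c) * (b * d)
  interchange = solve 4 (λ a b c d → (a :* b) :* (c :* d) := (a :* c) :* (b :* d)) refl

  *-^-distrib : ∀ m n k → (m * n) ^ k ≡ m ^ k * n ^ k
  *-^-distrib m n zero    = refl
  *-^-distrib m n (suc k) = trans (cong ((m * n) *_) (*-^-distrib m n k)) (interchange m n (m ^ k) (n ^ k))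

  growth-const : ∀ c → PolyGrowth (λ _ → c)
  growth-const c = c , 0 , λ x → ≤-reflexive (sym (*-identityʳ c))

  growth-suc : ∀ {g} → PolyGrowth g → PolyGrowth (λ x → suc (g x))
  growth-suc (a , k , h) = suc a , k , λ x → +-mono-≤ (m^n>0 (suc x) k) (h x)

  growth-+ : ∀ {g h} → PolyGrowth g → PolyGrowth h → PolyGrowth (λ x → g x + h x)
  growth-+ (a , k , hg) (b , l , hh) = a + b , k + l , λ x → begin
    _                                       ≤⟨ +-mono-≤ (hg x) (hh x) ⟩
    a * suc x ^ k + b * suc x ^ l           ≤⟨ +-mono-≤ (*-monoʳ-≤ a (^-monoʳ-≤ (suc x) (m≤m+n k l)))
                                                         (*-monoʳ-≤ b (^-monoʳ-≤ (suc x) (m≤n+m l k))) ⟩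
    a * suc x ^ (k + l) + b * suc x ^ (k + l) ≡⟨ sym (*-distribʳ-+ (suc x ^ (k + l)) a b) ⟩
    (a + b) * suc x ^ (k + l)               ∎

  growth-* : ∀ {g h} → PolyGrowth g → PolyGrowth h → PolyGrowth (λ x → g x * h x)
  growth-* (a , k , hg) (b , l , hh) = a * b , k + l , λ x → begin
    _                                       ≤⟨ *-mono-≤ (hg x) (hh x) ⟩
    (a * suc x ^ k) * (b * suc x ^ l)       ≡⟨ interchange a (suc x ^ k) b (suc x ^ l) ⟩
    (a * b) * (suc x ^ k * suc x ^ l)       ≡⟨ cong ((a * b) *_) (sym (^-distribˡ-+-* (suc x) k l)) ⟩
    (a * b) * suc x ^ (k + l)               ∎

  growth-≤ : ∀ {g h} → (∀ x → g x ≤ h x) → PolyGrowth h → PolyGrowth g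
  growth-≤ g≤h (a , k , hh) = a , k , λ x → ≤-trans (g≤h x) (hh x)

  polyBounded⇒growth : ∀ {s} → (∃ λ a → ∃ λ k → ∀ n → s n ≤ a * n ^ k + a) → PolyGrowth s
  polyBounded⇒growth (a , k , hs) = a + a , k , λ x → begin
    _                             ≤⟨ hs x ⟩
    a * x ^ k + a                 ≤⟨ +-mono-≤ (*-monoʳ-≤ a (^-monoˡ-≤ k (n≤1+n x))) (≤*suc^ a x k) ⟩
    a * suc x ^ k + a * suc x ^ k ≡⟨ sym (*-distribʳ-+ (suc x ^ k) a a) ⟩
    (a + a) * suc x ^ k           ∎

  suc^≤ : ∀ x k → suc x ^ k ≤ 2 ^ k * suc (x ^ k)
  suc^≤ zero k = begin
    1 ^ k               ≡⟨ ^-zeroˡ k ⟩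
    1                   ≤⟨ m^n>0 2 k ⟩
    2 ^ k               ≤⟨ m≤m*n (2 ^ k) (suc (0 ^ k)) ⟩
    2 ^ k * suc (0 ^ k) ∎
  suc^≤ (suc y) k = begin
    suc (suc y) ^ k         ≤⟨ ^-monoˡ-≤ k (m≤m+n (suc (suc y)) y) ⟩
    (suc (suc y) + y) ^ k   ≡⟨ cong (_^ k) (solve 1 (λ y → con 2 :+ y :+ y := con 2 :* (con 1 :+ y)) refl y) ⟩
    (2 * suc y) ^ k         ≡⟨ *-^-distrib 2 (suc y) k ⟩
    2 ^ k * suc y ^ k       ≤⟨ *-monoʳ-≤ (2 ^ k) (n≤1+n (suc y ^ k)) ⟩
    2 ^ k * suc (suc y ^ k) ∎

  growth⇒polyBounded : ∀ {g} → PolyGrowth g → ∃ λ a → ∃ λ k → ∀ n → g n ≤ a * n ^ k + a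
  growth⇒polyBounded (a , k , hg) = a * 2 ^ k , k , λ x → begin
    _                         ≤⟨ hg x ⟩
    a * suc x ^ k             ≤⟨ *-monoʳ-≤ a (suc^≤ x k) ⟩
    a * (2 ^ k * suc (x ^ k)) ≡⟨ solve 3 (λ a p y → a :* (p :* (con 1 :+ y)) := (a :* p) :* y :+ a :* p) refl a (2 ^ k) (x ^ k) ⟩
    a * 2 ^ k * x ^ k + a * 2 ^ k ∎

open PolynomialGrowth

split-compare : ∀ {a} {A : Set a} (X Y : List A) x y R S → X ++ x ∷ R ≡ Y ++ y ∷ S →
                (X ≡ Y × x ≡ y × R ≡ S) ⊎ ((∃ λ M → Y ≡ X ++ x ∷ M) ⊎ (∃ λ M → X ≡ Y ++ y ∷ M))
split-compare []      []      x y R S refl = inj₁ (refl , refl , refl)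
split-compare []      (_ ∷ Y) x y R S refl = inj₂ (inj₁ (Y , refl))
split-compare (_ ∷ X) []      x y R S refl = inj₂ (inj₂ (X , refl))
split-compare (_ ∷ X) (_ ∷ Y) x y R S e with ∷-injective e
... | refl , e′ with split-compare X Y x y R S e′
... | inj₁ (refl , x≡y , R≡S)  = inj₁ (refl , x≡y , R≡S)
... | inj₂ (inj₁ (M , refl))  = inj₂ (inj₁ (M , refl))
... | inj₂ (inj₂ (M , refl))  = inj₂ (inj₂ (M , refl))


module _ {a b} {A : Set a} {X : Set b} where

  ∈-concatMap-intro : ∀ (f : A → List X) {xs x z} → x ∈ xs → z ∈ f x → z ∈ concatMap f xs
  ∈-concatMap-intro f x∈ z∈ = ∈-concatMap⁺ f (lose x∈ z∈)

  ∈-concatMap-elim : ∀ (f : A → List X) {xs z} → z ∈ concatMap f xs → ∃ λ x → x ∈ xs × z ∈ f x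
  ∈-concatMap-elim f z∈ = find (∈-concatMap⁻ f z∈)

  unique-concatMap : ∀ (f : A → List X) {xs} → Unique xs → (∀ {x} → x ∈ xs → Unique (f x)) →
                     (∀ {x y z} → x ∈ xs → y ∈ xs → z ∈ f x → z ∈ f y → x ≡ y) →
                     Unique (concatMap f xs)
  unique-concatMap f {[]}     _          _  _  = []
  unique-concatMap f {x ∷ xs} (x∉ ∷ xs!) f! f# =
    Unique.++⁺ (f! (here refl)) (unique-concatMap f xs! (λ m → f! (there m)) (λ m m′ → f# (there m) (there m′)))
        disjoint
    where
      disjoint : Disjoint (f x) (concatMap f xs)
      disjoint (z∈fx , z∈rest) with ∈-concatMap-elim f z∈rest
      ... | y , y∈xs , z∈fy = All.lookup x∉ y∈xs (f# (here refl) (there y∈xs) z∈fx z∈fy)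

  whenJust : Maybe A → List X → List X
  whenJust nothing  _  = []
  whenJust (just _) xs = xs

  ∈-whenJust-elim : ∀ (m : Maybe A) {xs z} → z ∈ whenJust m xs → Σ A λ a → m ≡ just a × z ∈ xs
  ∈-whenJust-elim (just a) z∈ = a , refl , z∈

  ∈-whenJust-intro : ∀ {m : Maybe A} {a xs z} → m ≡ just a → z ∈ xs → z ∈ whenJust m xs
  ∈-whenJust-intro refl z∈ = z∈

  unique-whenJust : ∀ (m : Maybe A) {xs} → (∀ a → m ≡ just a → Unique xs) → Unique (whenJust m xs)
  unique-whenJust nothing  _  = []
  unique-whenJust (just a) xs! = xs! a refl

++-injective : ∀ {a} {A : Set a} (X Y : List A) {R S} → length X ≡ length Y → X ++ R ≡ Y ++ S → X ≡ Y × R ≡ S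
++-injective []      []      _   e = refl , e
++-injective (x ∷ X) (y ∷ Y) |X| e with ∷-injective e
... | refl , e′ with ++-injective X Y (cong pred |X|) e′
... | refl , R≡S = refl , R≡S

length-cartesianProduct : ∀ {a b} {A : Set a} {B : Set b} (xs : List A) (ys : List B) →
                          length (cartesianProduct xs ys) ≡ length xs * length ys
length-cartesianProduct []       ys = refl
length-cartesianProduct (x ∷ xs) ys =
  trans (length-++ (map (x ,_) ys)) (cong₂ _+_ (length-map (x ,_) ys) (length-cartesianProduct xs ys))

length-split< : ∀ {a} {A : Set a} (X : List A) {y : A} {Y k} → length (X ++ y ∷ Y) < k →
                length X < k × length Y < k
length-split< X {y} {Y} {k} |XyY|<k = ≤-trans (s≤s (m≤m+n (length X) (length Y))) |XY|<k
                                    , ≤-trans (s≤s (m≤n+m (length Y) (length X))) |XY|<k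
  where
    |XY|<k : length X + length Y < k
    |XY|<k = ≤-trans (n≤1+n _)
               (≤-trans (s≤s (≤-reflexive (sym (trans (length-++ X) (+-suc (length X) (length Y)))))) |XyY|<k)


module StackWords {c ℓ : Level} (R : CommutativeRing c ℓ) (k : ℕ) where
  open Over R using (StackOp; push; pop; nop; Realizable; empty; wrap; nopˡ; nopʳ; concat)

  -- Balanced words: the unambiguous grammar  D ::= ε | nop D | push s D pop s D
  -- generating exactly the realizable sequences.
  data Balanced : List (StackOp k) → Set where
    ε       : Balanced []
    nop∷    : ∀ {D} → Balanced D → Balanced (nop ∷ D)
    bracket : ∀ {D D′} (s : Fin k) → Balanced D → Balanced D′ →
              Balanced (push s ∷ D ++ pop s ∷ D′)

  balanced-++ : ∀ {P Q} → Balanced P → Balanced Q → Balanced (P ++ Q)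
  balanced-++ ε           q = q
  balanced-++ (nop∷ p)    q = nop∷ (balanced-++ p q)
  balanced-++ {Q = Q} (bracket {D} {D′} s d d′) q =
    subst Balanced (cong (push s ∷_) (sym (++-assoc D (pop s ∷ D′) Q))) (bracket s d (balanced-++ d′ q))

  realizable⇒balanced : ∀ {P} → Realizable P → Balanced P
  realizable⇒balanced empty        = ε
  realizable⇒balanced (wrap s r)   = bracket s (realizable⇒balanced r) ε
  realizable⇒balanced (nopˡ r)     = nop∷ (realizable⇒balanced r)
  realizable⇒balanced (nopʳ r)     = balanced-++ (realizable⇒balanced r) (nop∷ ε)
  realizable⇒balanced (concat r q) = balanced-++ (realizable⇒balanced r) (realizable⇒balanced q)

  balanced⇒realizable : ∀ {P} → Balanced P → Realizable P
  balanced⇒realizable ε          = empty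
  balanced⇒realizable (nop∷ d)   = nopˡ (balanced⇒realizable d)
  balanced⇒realizable (bracket {D} {D′} s d d′) =
    subst Realizable (cong (push s ∷_) (++-assoc D (pop s ∷ []) D′))
          (concat (wrap s (balanced⇒realizable d)) (balanced⇒realizable d′))

  balanced-nop⁻ : ∀ {X} → Balanced (nop ∷ X) → Balanced X
  balanced-nop⁻ (nop∷ d) = d

  balanced-pop⁻ : ∀ {s X} → Balanced (pop s ∷ X) → ⊥
  balanced-pop⁻ ()

  balanced-push⁻ : ∀ {s X} → Balanced (push s ∷ X) →
                   ∃ λ D → ∃ λ D′ → X ≡ D ++ pop s ∷ D′ × Balanced D × Balanced D′
  balanced-push⁻ (bracket {D} {D′} _ d d′) = D , D′ , refl , d , d′

  -- The stack height after running a word from height h (nothing on underflow).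
  height : List (StackOp k) → ℕ → Maybe ℕ
  height []            h       = just h
  height (nop    ∷ P)  h       = height P h
  height (push _ ∷ P)  h       = height P (suc h)
  height (pop _  ∷ P)  zero    = nothing
  height (pop _  ∷ P)  (suc h) = height P h

  height-++ : ∀ P Q h h′ → height P h ≡ just h′ → height (P ++ Q) h ≡ height Q h′
  height-++ []           Q h       .h refl = refl
  height-++ (nop    ∷ P) Q h       h′ e    = height-++ P Q h h′ e
  height-++ (push _ ∷ P) Q h       h′ e    = height-++ P Q (suc h) h′ e
  height-++ (pop _  ∷ P) Q (suc h) h′ e    = height-++ P Q h h′ e

  balanced-height : ∀ {D} → Balanced D → ∀ h → height D h ≡ just h
  balanced-height ε          h = refl
  balanced-height (nop∷ d)   h = balanced-height d h
  balanced-height (bracket {D} {D′} s d d′) h =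
    trans (height-++ D (pop s ∷ D′) (suc h) (suc h) (balanced-height d (suc h))) (balanced-height d′ h)

  balanced-pop-unbalanced : ∀ {X} M s → Balanced X → Balanced (X ++ pop s ∷ M) → ⊥
  balanced-pop-unbalanced {X} M s bx by
    with trans (sym (height-++ X (pop s ∷ M) 0 0 (balanced-height bx 0))) (balanced-height by 0)
  ... | ()

  balanced-prefix-unique : ∀ {X Y} s t R S → Balanced X → Balanced Y →
                           X ++ pop s ∷ R ≡ Y ++ pop t ∷ S → X ≡ Y
  balanced-prefix-unique {X} {Y} s t R S bx by e with split-compare X Y (pop s) (pop t) R S e
  ... | inj₁ (X≡Y , _ , _)    = X≡Y
  ... | inj₂ (inj₁ (M , refl)) = ⊥-elim (balanced-pop-unbalanced M s bx by)
  ... | inj₂ (inj₂ (M , refl)) = ⊥-elim (balanced-pop-unbalanced M t by bx)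


module PolyAlgebra {c ℓ : Level} (R : CommutativeRing c ℓ) where
  open Over R
  open CommutativeRing R using (0#; 1#; -_)

  ≈P-setoid : Setoid c (c ⊔ ℓ)
  ≈P-setoid = record { Carrier = Poly ; _≈_ = _≈P_
                     ; isEquivalence = record { refl = refl≈ ; sym = sym≈ ; trans = trans≈ } }

  module ≈P-Reasoning = Relation.Binary.Reasoning.Setoid ≈P-setoid

  ≡⇒≈P : ∀ {p q} → p ≡ q → p ≈P q
  ≡⇒≈P refl = refl≈

  ⊕-idʳ : ∀ p → p ⊕ con 0# ≈P p
  ⊕-idʳ p = trans≈ (⊕-comm p (con 0#)) (⊕-idˡ p)

  -- 0 is absorbing (from the ring axioms: p·0 = p·0 + p·0 − p·0)
  ⊗-zeroʳ : ∀ p → p ⊗ con 0# ≈P con 0#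
  ⊗-zeroʳ p = begin
    p0                    ≈⟨ sym≈ (⊕-idʳ p0) ⟩
    p0 ⊕ con 0#           ≈⟨ ⊕-cong refl≈ (sym≈ (⊕-invʳ p0)) ⟩
    p0 ⊕ (p0 ⊕ -p0)       ≈⟨ sym≈ (⊕-assoc p0 p0 -p0) ⟩
    (p0 ⊕ p0) ⊕ -p0       ≈⟨ ⊕-cong (sym≈ (distribˡ p (con 0#) (con 0#))) refl≈ ⟩
    p ⊗ (con 0# ⊕ con 0#) ⊕ -p0 ≈⟨ ⊕-cong (⊗-cong refl≈ (⊕-idˡ (con 0#))) refl≈ ⟩
    p0 ⊕ -p0              ≈⟨ ⊕-invʳ p0 ⟩
    con 0#                ∎
    where
      p0 = p ⊗ con 0#
      -p0 = con (- 1#) ⊗ p0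
      open ≈P-Reasoning

  -- Finite sums over a list, written as the right fold used in Defs.
  module _ {a} {A : Set a} where
    sumOf : (A → Poly) → List A → Poly
    sumOf f = foldr (λ x acc → f x ⊕ acc) (con 0#)

    sumOf-cong : ∀ {f g : A → Poly} xs → (∀ x → x ∈ xs → f x ≈P g x) → sumOf f xs ≈P sumOf g xs
    sumOf-cong []       _   = refl≈
    sumOf-cong (x ∷ xs) f≈g = ⊕-cong (f≈g x (here refl)) (sumOf-cong xs (λ y y∈ → f≈g y (there y∈)))

    sumOf-++ : ∀ (f : A → Poly) xs ys → sumOf f (xs ++ ys) ≈P sumOf f xs ⊕ sumOf f ys
    sumOf-++ f []       ys = sym≈ (⊕-idˡ _)
    sumOf-++ f (x ∷ xs) ys = trans≈ (⊕-cong refl≈ (sumOf-++ f xs ys)) (sym≈ (⊕-assoc _ _ _))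

    sumOf-scaleˡ : ∀ (f : A → Poly) p xs → sumOf (λ x → p ⊗ f x) xs ≈P p ⊗ sumOf f xs
    sumOf-scaleˡ f p []       = sym≈ (⊗-zeroʳ p)
    sumOf-scaleˡ f p (x ∷ xs) = trans≈ (⊕-cong refl≈ (sumOf-scaleˡ f p xs)) (sym≈ (distribˡ _ _ _))

    sumOf-scaleʳ : ∀ (f : A → Poly) p xs → sumOf (λ x → f x ⊗ p) xs ≈P sumOf f xs ⊗ p
    sumOf-scaleʳ f p xs =
      trans≈ (sumOf-cong xs (λ x _ → ⊗-comm (f x) p)) (trans≈ (sumOf-scaleˡ f p xs) (⊗-comm p _))

    sumOf-↭ : ∀ (f : A → Poly) {xs ys} → xs ↭ ys → sumOf f xs ≈P sumOf f ys
    sumOf-↭ f ↭.refl          = refl≈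
    sumOf-↭ f (↭.prep x xs↭ys) = ⊕-cong refl≈ (sumOf-↭ f xs↭ys)
    sumOf-↭ f (↭.swap x y xs↭ys) =
      trans≈ (sym≈ (⊕-assoc _ _ _)) (trans≈ (⊕-cong (⊕-comm _ _) (sumOf-↭ f xs↭ys)) (⊕-assoc _ _ _))
    sumOf-↭ f (↭.trans xs↭ys ys↭zs) = trans≈ (sumOf-↭ f xs↭ys) (sumOf-↭ f ys↭zs)

  module _ {a b} {A : Set a} {B : Set b} where
    sumOf-map : ∀ (f : B → Poly) (g : A → B) xs → sumOf f (map g xs) ≡ sumOf (λ x → f (g x)) xs
    sumOf-map f g []       = refl
    sumOf-map f g (x ∷ xs) = cong (f (g x) ⊕_) (sumOf-map f g xs)

    sumOf-concatMap : ∀ (f : B → Poly) (g : A → List B) xs →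
                      sumOf f (concatMap g xs) ≈P sumOf (λ x → sumOf f (g x)) xs
    sumOf-concatMap f g []       = refl≈
    sumOf-concatMap f g (x ∷ xs) = trans≈ (sumOf-++ f (g x) (concatMap g xs)) (⊕-cong refl≈ (sumOf-concatMap f g xs))


data Term {c} (K : Set c) (I : Set) : Set c where
  hole  : I → Term K I
  tcon  : K → Term K I
  tvar  : ℕ → Term K I
  _⊕ᵗ_  : Term K I → Term K I → Term K I
  _⊗ᵗ_  : Term K I → Term K I → Term K I

-- number of nodes, i.e. the number of gates needed to compute the term
tsize : ∀ {c} {K : Set c} {I} → Term K I → ℕ
tsize (hole _)  = 1
tsize (tcon _)  = 1
tsize (tvar _)  = 1
tsize (s ⊕ᵗ t)  = suc (tsize s + tsize t)
tsize (s ⊗ᵗ t)  = suc (tsize s + tsize t)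

module TermSemantics {c ℓ : Level} (R : CommutativeRing c ℓ) where
  open Over R
  open PolyAlgebra R
  open CommutativeRing R using (0#) renaming (Carrier to F)

  ⟦_⟧ : ∀ {I} → Term F I → (I → Poly) → Poly
  ⟦ hole i ⟧ ρ = ρ i
  ⟦ tcon a ⟧ ρ = con a
  ⟦ tvar x ⟧ ρ = var x
  ⟦ s ⊕ᵗ t ⟧ ρ = ⟦ s ⟧ ρ ⊕ ⟦ t ⟧ ρ
  ⟦ s ⊗ᵗ t ⟧ ρ = ⟦ s ⟧ ρ ⊗ ⟦ t ⟧ ρ

  Σᵗ : ∀ {I} {A : Set} → List A → (A → Term F I) → Term F I
  Σᵗ xs f = foldr (λ x acc → f x ⊕ᵗ acc) (tcon 0#) xs

  ⟦Σᵗ⟧ : ∀ {I} {A : Set} (xs : List A) (f : A → Term F I) ρ → ⟦ Σᵗ xs f ⟧ ρ ≡ sumOf (λ x → ⟦ f x ⟧ ρ) xs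
  ⟦Σᵗ⟧ []       f ρ = refl
  ⟦Σᵗ⟧ (x ∷ xs) f ρ = cong (⟦ f x ⟧ ρ ⊕_) (⟦Σᵗ⟧ xs f ρ)

  tsize-Σᵗ : ∀ {I} {A : Set} (xs : List A) (f : A → Term F I) {M} → (∀ x → tsize (f x) ≤ M) →
             tsize (Σᵗ xs f) ≤ suc (length xs) * suc M
  tsize-Σᵗ []       f f≤M = s≤s z≤n
  tsize-Σᵗ (x ∷ xs) f f≤M = s≤s (+-mono-≤ (f≤M x) (tsize-Σᵗ xs f f≤M))


module SBPPaths {c ℓ : Level} (R : CommutativeRing c ℓ) (B : Over.SBP R) where
  open Over R
  open SBP B
  open StackWords R symbols

  V : Set
  V = Fin size

  Label : Set c
  Label = Weight × StackOp symbols

  opsFrom : V → List V → List (StackOp symbols)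
  opsFrom u t = map proj₂ (labelsFrom B u t)

  -- Path u t v: the vertex sequence u ∷ t is a path from u to v.
  data Path : V → List V → V → Set c where
    stop : ∀ {u} → Path u [] u
    hop  : ∀ {u u′ t v} (l : Label) → edge u u′ ≡ just l → Path u′ t v → Path u (u′ ∷ t) v

  labelsFrom-hop : ∀ {u u′ t l} → edge u u′ ≡ just l → labelsFrom B u (u′ ∷ t) ≡ l ∷ labelsFrom B u′ t
  labelsFrom-hop {u} {u′} e with edge u u′
  labelsFrom-hop refl | just _ = refl

  labelsFrom-++ : ∀ {u t x} r → Path u t x → labelsFrom B u (t ++ r) ≡ labelsFrom B u t ++ labelsFrom B x r
  labelsFrom-++ r stop = refl
  labelsFrom-++ r (hop l e p) =
    trans (labelsFrom-hop e) (trans (cong (l ∷_) (labelsFrom-++ r p)) (cong (_++ _) (sym (labelsFrom-hop e))))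

  opsFrom-hop : ∀ {u u′ t w o} → edge u u′ ≡ just (w , o) → opsFrom u (u′ ∷ t) ≡ o ∷ opsFrom u′ t
  opsFrom-hop e = cong (map proj₂) (labelsFrom-hop e)

  opsFrom-split : ∀ {u t x y r w o} → Path u t x → edge x y ≡ just (w , o) →
                  opsFrom u (t ++ y ∷ r) ≡ opsFrom u t ++ o ∷ opsFrom y r
  opsFrom-split {u} {t} p e =
    trans (cong (map proj₂) (trans (labelsFrom-++ _ p) (cong (labelsFrom B u t ++_) (labelsFrom-hop e))))
          (map-++ proj₂ (labelsFrom B u t) _)

  opsFrom-length : ∀ {u t v} → Path u t v → length (opsFrom u t) ≡ length t
  opsFrom-length stop        = refl
  opsFrom-length (hop l e p) = trans (cong length (opsFrom-hop e)) (cong suc (opsFrom-length p))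

  path-end-unique : ∀ {u t v v′} → Path u t v → Path u t v′ → v ≡ v′
  path-end-unique stop        stop          = refl
  path-end-unique (hop _ _ p) (hop _ _ p′) = path-end-unique p p′

  path-++ : ∀ {u t x y r v l} → Path u t x → edge x y ≡ just l → Path y r v → Path u (t ++ y ∷ r) v
  path-++ stop         e q = hop _ e q
  path-++ (hop l e′ p) e q = hop l e′ (path-++ p e q)

  record Canonical (u v : V) (z : List V) : Set c where
    constructor canonical
    field
      rest     : List V
      shape    : z ≡ u ∷ rest
      path     : Path u rest v
      balanced : Balanced (opsFrom u rest)

  balanced-split-unique : ∀ {u tp x y tq w s tp′ x′ y′ tq′ w′ s′} →
    Path u tp x  → Balanced (opsFrom u tp)  → edge x y ≡ just (w , pop s) →
    Path u tp′ x′ → Balanced (opsFrom u tp′) → edge x′ y′ ≡ just (w′ , pop s′) →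
    tp ++ y ∷ tq ≡ tp′ ++ y′ ∷ tq′ → tp ≡ tp′ × x ≡ x′ × y ≡ y′ × tq ≡ tq′
  balanced-split-unique {u} {tp} {tp′ = tp′} p b e p′ b′ e′ eq
    with ++-injective tp tp′ same-length eq
    where
      same-ops : opsFrom u tp ≡ opsFrom u tp′
      same-ops = balanced-prefix-unique _ _ _ _ b b′
                   (trans (sym (opsFrom-split p e)) (trans (cong (opsFrom u) eq) (opsFrom-split p′ e′)))
      same-length : length tp ≡ length tp′
      same-length = trans (sym (opsFrom-length p)) (trans (cong length same-ops) (opsFrom-length p′))
  ... | refl , e-rest with ∷-injective e-rest
  ... | refl , refl = refl , path-end-unique p p′ , refl , refl


module PathEnumeration {c ℓ : Level} (R : CommutativeRing c ℓ) (B : Over.SBP R) where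
  open Over R
  open SBP B
  open StackWords R symbols
  open SBPPaths R B

  nopWeight : Maybe Label → Maybe Weight
  nopWeight (just (w , nop)) = just w
  nopWeight _                = nothing

  bracketWeights : Maybe Label → Maybe Label → Maybe (Weight × Weight)
  bracketWeights (just (w₁ , push s)) (just (w₂ , pop t)) with s ≟ t
  ... | yes _ = just (w₁ , w₂)
  ... | no  _ = nothing
  bracketWeights _ _ = nothing

  nopWeight-inv : ∀ m {w} → nopWeight m ≡ just w → m ≡ just (w , nop)
  nopWeight-inv (just (w , nop)) refl = refl

  bracketWeights-inv : ∀ m₁ m₂ {w₁ w₂} → bracketWeights m₁ m₂ ≡ just (w₁ , w₂) →
                       Σ (Fin symbols) λ s → m₁ ≡ just (w₁ , push s) × m₂ ≡ just (w₂ , pop s)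
  bracketWeights-inv (just (w₁ , push s)) (just (w₂ , pop t)) e with s ≟ t
  bracketWeights-inv (just (w₁ , push s)) (just (w₂ , pop .s)) refl | yes refl = s , refl , refl

  bracketWeights-match : ∀ w₁ w₂ s → bracketWeights (just (w₁ , push s)) (just (w₂ , pop s)) ≡ just (w₁ , w₂)
  bracketWeights-match w₁ w₂ s with s ≟ s
  ... | yes _ = refl
  ... | no s≢s = ⊥-elim (s≢s refl)

  vertices : List V
  vertices = allFin size

  triples : List (V × V × V)
  triples = cartesianProduct vertices (cartesianProduct vertices vertices)

  PathTable : Set
  PathTable = V → V → List (List V)

  trivial : V → V → List (List V)
  trivial u v with u ≟ v
  ... | yes _ = (u ∷ []) ∷ []
  ... | no  _ = []

  nopStep : PathTable → V → V → V → List (List V)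
  nopStep P u v u′ = whenJust (nopWeight (edge u u′)) (map (u ∷_) (P u′ v))

  joins : V → List (List V) → List (List V) → List (List V)
  joins u ps qs = concatMap (λ p → map (λ q → u ∷ p ++ q) qs) ps

  -- first edge u → u′ pushes a symbol that is popped by the edge x → y
  bracketStep : PathTable → V → V → V × V × V → List (List V)
  bracketStep P u v (u′ , x , y) = whenJust (bracketWeights (edge u u′) (edge x y)) (joins u (P u′ x) (P y v))

  -- One step of the decomposition of balanced words (D ::= ε | nop D | push D pop D)
  -- read on paths.
  extend : PathTable → PathTable
  extend P u v = trivial u v ++ (concatMap (nopStep P u v) vertices ++ concatMap (bracketStep P u v) triples)

  -- paths k u v: the canonical u-v paths with fewer than k edges.
  paths : ℕ → PathTable
  paths zero    _ _ = []
  paths (suc k)     = extend (paths k)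

  record NopView (P : PathTable) (u v u′ : V) (z : List V) : Set c where
    constructor nopView
    field
      w    : Weight
      p    : List V
      nop≡ : edge u u′ ≡ just (w , nop)
      p∈   : p ∈ P u′ v
      z≡   : z ≡ u ∷ p

  record BracketView (P : PathTable) (u v u′ x y : V) (z : List V) : Set c where
    constructor bracketView
    field
      w₁ w₂ : Weight
      s     : Fin symbols
      p q   : List V
      push≡ : edge u u′ ≡ just (w₁ , push s)
      pop≡  : edge x y ≡ just (w₂ , pop s)
      p∈    : p ∈ P u′ x
      q∈    : q ∈ P y v
      z≡    : z ≡ u ∷ p ++ q

  trivial-view : ∀ {u v z} → z ∈ trivial u v → u ≡ v × z ≡ u ∷ []
  trivial-view {u} {v} z∈ with u ≟ v
  trivial-view (here refl) | yes u≡v = u≡v , refl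

  nopStep-view : ∀ {P u v u′ z} → z ∈ nopStep P u v u′ → NopView P u v u′ z
  nopStep-view {P} {u} {v} {u′} z∈ with ∈-whenJust-elim (nopWeight (edge u u′)) z∈
  ... | w , e , z∈′ with ∈-map⁻ (u ∷_) z∈′
  ... | p , p∈ , refl = nopView w p (nopWeight-inv (edge u u′) e) p∈ refl

  nops-view : ∀ {P u v z} → z ∈ concatMap (nopStep P u v) vertices → Σ V λ u′ → NopView P u v u′ z
  nops-view {P} {u} {v} z∈ with ∈-concatMap-elim (nopStep P u v) {vertices} z∈
  ... | u′ , _ , z∈′ = u′ , nopStep-view z∈′

  bracketStep-view : ∀ {P u v u′ x y z} → z ∈ bracketStep P u v (u′ , x , y) → BracketView P u v u′ x y z
  bracketStep-view {P} {u} {v} {u′} {x} {y} z∈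
    with ∈-whenJust-elim (bracketWeights (edge u u′) (edge x y)) z∈
  ... | (w₁ , w₂) , e , z∈′ with bracketWeights-inv (edge u u′) (edge x y) e
  ... | s , push≡ , pop≡ with ∈-concatMap-elim (λ p → map (λ q → u ∷ p ++ q) (P y v)) {P u′ x} z∈′
  ... | p , p∈ , z∈″ with ∈-map⁻ (λ q → u ∷ p ++ q) z∈″
  ... | q , q∈ , refl = bracketView w₁ w₂ s p q push≡ pop≡ p∈ q∈ refl

  brackets-view : ∀ {P u v z} → z ∈ concatMap (bracketStep P u v) triples →
                  Σ (V × V × V) λ { (u′ , x , y) → BracketView P u v u′ x y z }
  brackets-view {P} {u} {v} z∈ with ∈-concatMap-elim (bracketStep P u v) {triples} z∈
  ... | (u′ , x , y) , _ , z∈′ = (u′ , x , y) , bracketStep-view z∈′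

  Sound : PathTable → Set c
  Sound P = ∀ {u v z} → z ∈ P u v → Canonical u v z

  canonical-trivial : ∀ {u} → Canonical u u (u ∷ [])
  canonical-trivial = canonical [] refl stop ε

  canonical-nop : ∀ {u u′ v p w} → edge u u′ ≡ just (w , nop) → Canonical u′ v p → Canonical u v (u ∷ p)
  canonical-nop {u} {u′} e (canonical t refl path b) =
    canonical (u′ ∷ t) refl (hop _ e path) (subst Balanced (sym (opsFrom-hop e)) (nop∷ b))

  canonical-bracket : ∀ {u u′ x y v p q w₁ w₂ s} → edge u u′ ≡ just (w₁ , push s) → edge x y ≡ just (w₂ , pop s) →
                      Canonical u′ x p → Canonical y v q → Canonical u v (u ∷ p ++ q)
  canonical-bracket {u} {u′} {y = y} {s = s} e₁ e₂ (canonical tp refl pp bp) (canonical tq refl pq bq) =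
    canonical (u′ ∷ tp ++ y ∷ tq) refl (hop _ e₁ (path-++ pp e₂ pq))
              (subst Balanced (sym (trans (opsFrom-hop e₁) (cong (push s ∷_) (opsFrom-split pp e₂))))
                     (bracket s bp bq))

  extend-sound : ∀ {P} → Sound P → Sound (extend P)
  extend-sound {P} sound {u} {v} z∈ with ∈-++⁻ (trivial u v) z∈
  ... | inj₁ z∈t with trivial-view z∈t
  ...   | refl , refl = canonical-trivial
  extend-sound {P} sound {u} {v} z∈ | inj₂ z∈′ with ∈-++⁻ (concatMap (nopStep P u v) vertices) z∈′
  ... | inj₁ z∈n with nops-view {P} {u} {v} z∈n
  ...   | _ , nopView _ _ e p∈ refl = canonical-nop e (sound p∈)
  extend-sound {P} sound {u} {v} z∈ | inj₂ z∈′ | inj₂ z∈b with brackets-view {P} {u} {v} z∈b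
  ...   | _ , bracketView _ _ _ _ _ e₁ e₂ p∈ q∈ refl = canonical-bracket e₁ e₂ (sound p∈) (sound q∈)

  paths-sound : ∀ k → Sound (paths k)
  paths-sound zero    ()
  paths-sound (suc k) = extend-sound (paths-sound k)

  record PopSplit (u : V) (t : List V) (v : V) (s : Fin symbols) (D D′ : List (StackOp symbols)) : Set c where
    constructor popSplit
    field
      tp     : List V
      x y    : V
      tq     : List V
      w      : Weight
      t≡     : t ≡ tp ++ y ∷ tq
      before : Path u tp x
      pop≡   : edge x y ≡ just (w , pop s)
      after  : Path y tq v
      D≡     : opsFrom u tp ≡ D
      D′≡    : opsFrom y tq ≡ D′

  split-at-pop : ∀ D {u t v s D′} → Path u t v → opsFrom u t ≡ D ++ pop s ∷ D′ → PopSplit u t v s D D′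
  split-at-pop []      stop ()
  split-at-pop (_ ∷ _) stop ()
  split-at-pop []      (hop {u} {u′} {t} (w , o) e p) ops≡ with ∷-injective (trans (sym (opsFrom-hop e)) ops≡)
  ... | refl , D′≡ = popSplit [] u u′ t w refl stop e p refl D′≡
  split-at-pop (o ∷ D) (hop {u} {u′} (w , o′) e p) ops≡ with ∷-injective (trans (sym (opsFrom-hop e)) ops≡)
  ... | refl , ops≡′ with split-at-pop D p ops≡′
  ... | popSplit tp x y tq w′ refl before pop≡ after D≡ D′≡ =
        popSplit (u′ ∷ tp) x y tq w′ refl (hop _ e before) pop≡ after (trans (opsFrom-hop e) (cong (o ∷_) D≡)) D′≡

  trivial-self : ∀ u → (u ∷ []) ∈ trivial u u
  trivial-self u with u ≟ u
  ... | yes _   = here refl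
  ... | no u≢u  = ⊥-elim (u≢u refl)

  Complete : ℕ → PathTable → Set c
  Complete k P = ∀ {u v t} → Path u t v → Balanced (opsFrom u t) → length t < k → (u ∷ t) ∈ P u v

  extend-complete : ∀ {k P} → Complete k P → Complete (suc k) (extend P)
  extend-complete {k} {P} complete {u} stop _ _ = ∈-++⁺ˡ (trivial-self u)
  extend-complete {k} {P} complete {u} {v} (hop {u′ = u′} {t} (w , nop) e p) b (s≤s |t|<k) =
    ∈-++⁺ʳ (trivial u v) (∈-++⁺ˡ (∈-concatMap-intro (nopStep P u v) (∈-allFin u′)
      (∈-whenJust-intro (cong nopWeight e)
        (∈-map⁺ (u ∷_) (complete p (balanced-nop⁻ (subst Balanced (opsFrom-hop e) b)) |t|<k)))))
  extend-complete complete (hop (w , pop s) e p) b _ =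
    ⊥-elim (balanced-pop⁻ (subst Balanced (opsFrom-hop e) b))
  extend-complete {k} {P} complete {u} {v} (hop {u′ = u′} {t} (w₁ , push s) e p) b (s≤s |t|<k)
    with balanced-push⁻ (subst Balanced (opsFrom-hop e) b)
  ... | D , D′ , ops≡ , bD , bD′ with split-at-pop D p ops≡
  ... | popSplit tp x y tq w₂ refl before pop≡ after refl refl with length-split< tp |t|<k
  ... | |tp|<k , |tq|<k =
    ∈-++⁺ʳ (trivial u v) (∈-++⁺ʳ (concatMap (nopStep P u v) vertices)
      (∈-concatMap-intro (bracketStep P u v) (∈-cartesianProduct⁺ (∈-allFin u′) (∈-cartesianProduct⁺ (∈-allFin x) (∈-allFin y)))
        (∈-whenJust-intro (trans (cong₂ bracketWeights e pop≡) (bracketWeights-match w₁ w₂ s))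
          (∈-concatMap-intro (λ p → map (λ q → u ∷ p ++ q) (P y v)) (complete before bD |tp|<k)
            (∈-map⁺ (λ q → u ∷ (u′ ∷ tp) ++ q) (complete after bD′ |tq|<k))))))

  paths-complete : ∀ k → Complete k (paths k)
  paths-complete zero    _ _ ()
  paths-complete (suc k) = extend-complete (paths-complete k)

  -- The second vertex of a sequence; it identifies the first edge.
  second : List V → Maybe V
  second (_ ∷ y ∷ _) = just y
  second _           = nothing

  module _ {P : PathTable} (sound : Sound P) where

    nopView-second : ∀ {u v u′ z} → NopView P u v u′ z → second z ≡ just u′
    nopView-second (nopView _ _ _ p∈ refl) with sound p∈
    ... | canonical _ refl _ _ = refl

    bracketView-second : ∀ {u v u′ x y z} → BracketView P u v u′ x y z → second z ≡ just u′
    bracketView-second (bracketView _ _ _ _ _ _ _ p∈ _ refl) with sound p∈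
    ... | canonical _ refl _ _ = refl

    join-determined : ∀ {u′ x y v u₂ x₂ y₂ p q p₂ q₂ w s w₂ s₂} →
      edge x y ≡ just (w , pop s) → edge x₂ y₂ ≡ just (w₂ , pop s₂) →
      p ∈ P u′ x → q ∈ P y v → p₂ ∈ P u₂ x₂ → q₂ ∈ P y₂ v → p ++ q ≡ p₂ ++ q₂ →
      u′ ≡ u₂ × x ≡ x₂ × y ≡ y₂ × p ≡ p₂
    join-determined e e₂ p∈ q∈ p₂∈ q₂∈ eq
      with sound p∈ | sound q∈ | sound p₂∈ | sound q₂∈
    ... | canonical _ refl pp bp | canonical _ refl _ _ | canonical _ refl pp₂ bp₂ | canonical _ refl _ _
      with ∷-injective eq
    ... | refl , eq′ with balanced-split-unique pp bp e pp₂ bp₂ e₂ eq′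
    ... | refl , refl , refl , refl = refl , refl , refl , refl

    bracketView-determined : ∀ {u v u′ x y u₂ x₂ y₂ z} →
      BracketView P u v u′ x y z → BracketView P u v u₂ x₂ y₂ z → (u′ , x , y) ≡ (u₂ , x₂ , y₂)
    bracketView-determined (bracketView _ _ _ _ _ _ e p∈ q∈ refl) (bracketView _ _ _ _ _ _ e₂ p₂∈ q₂∈ eq)
      with join-determined e e₂ p∈ q∈ p₂∈ q₂∈ (∷-injectiveʳ eq)
    ... | refl , refl , refl , _ = refl

    module _ (P! : ∀ u v → Unique (P u v)) (u v : V) where

      vertices! : Unique vertices
      vertices! = Unique.allFin⁺ size

      trivial-unique : Unique (trivial u v)
      trivial-unique with u ≟ v
      ... | yes _ = [] ∷ []
      ... | no  _ = []

      -- distinct first edges give distinct second vertices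
      nops-unique : Unique (concatMap (nopStep P u v) vertices)
      nops-unique = unique-concatMap (nopStep P u v) vertices!
        (λ {u′} _ → unique-whenJust (nopWeight (edge u u′)) (λ _ _ → Unique.map⁺ ∷-injectiveʳ (P! u′ v)))
        (λ {u′} {u₂} _ _ z∈ z∈₂ → just-injective
           (trans (sym (nopView-second (nopStep-view {P} {u} {v} {u′} z∈)))
                  (nopView-second (nopStep-view {P} {u} {v} {u₂} z∈₂))))

      joins-unique : ∀ {u′ x y w s} → edge x y ≡ just (w , pop s) → Unique (joins u (P u′ x) (P y v))
      joins-unique {u′} {x} {y} e = unique-concatMap _ (P! u′ x)
        (λ {p} _ → Unique.map⁺ (λ eq → ++-cancelˡ p _ _ (∷-injectiveʳ eq)) (P! y v))
        same-prefix
        where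
          same-prefix : ∀ {p p₂ z} → p ∈ P u′ x → p₂ ∈ P u′ x →
                        z ∈ map (λ q → u ∷ p ++ q) (P y v) → z ∈ map (λ q → u ∷ p₂ ++ q) (P y v) → p ≡ p₂
          same-prefix {p} {p₂} p∈ p₂∈ z∈ z∈₂ with ∈-map⁻ (λ q → u ∷ p ++ q) z∈ | ∈-map⁻ (λ q → u ∷ p₂ ++ q) z∈₂
          ... | q , q∈ , refl | q₂ , q₂∈ , eq =
            proj₂ (proj₂ (proj₂ (join-determined e e p∈ q∈ p₂∈ q₂∈ (∷-injectiveʳ eq))))

      -- a path determines its bracket  (u′ , x , y)
      brackets-unique : Unique (concatMap (bracketStep P u v) triples)
      brackets-unique = unique-concatMap (bracketStep P u v)
        (Unique.cartesianProduct⁺ vertices! (Unique.cartesianProduct⁺ vertices! vertices!))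
        (λ { {u′ , x , y} _ → unique-whenJust (bracketWeights (edge u u′) (edge x y))
               (λ _ ws≡ → joins-unique (proj₂ (proj₂ (bracketWeights-inv (edge u u′) (edge x y) ws≡)))) })
        (λ { {u′ , x , y} {u₂ , x₂ , y₂} _ _ z∈ z∈₂ →
               bracketView-determined (bracketStep-view {P} {u} {v} {u′} {x} {y} z∈)
                                      (bracketStep-view {P} {u} {v} {u₂} {x₂} {y₂} z∈₂) })

      -- a nop edge and a push edge cannot both leave u towards the second vertex
      nops#brackets : Disjoint (concatMap (nopStep P u v) vertices) (concatMap (bracketStep P u v) triples)
      nops#brackets (z∈n , z∈b) with nops-view {P} {u} {v} z∈n | brackets-view {P} {u} {v} z∈b
      ... | u′ , nv | _ , bv with just-injective (trans (sym (nopView-second nv)) (bracketView-second bv))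
      ... | refl with trans (sym (NopView.nop≡ nv)) (BracketView.push≡ bv)
      ... | ()

      -- the trivial path has no second vertex
      trivial#rest : Disjoint (trivial u v) (concatMap (nopStep P u v) vertices ++ concatMap (bracketStep P u v) triples)
      trivial#rest (z∈t , z∈r) with trivial-view z∈t | ∈-++⁻ (concatMap (nopStep P u v) vertices) z∈r
      ... | _ , refl | inj₁ z∈n with nopView-second (proj₂ (nops-view {P} {u} {v} z∈n))
      ...   | ()
      trivial#rest (z∈t , z∈r) | _ , refl | inj₂ z∈b with bracketView-second (proj₂ (brackets-view {P} {u} {v} z∈b))
      ...   | ()

      -- Uniqueness: extend P lists each path at most once, because the
      -- decomposition of a balanced word is unique.
      extend-unique : Unique (extend P u v)
      extend-unique = Unique.++⁺ trivial-unique (Unique.++⁺ nops-unique brackets-unique nops#brackets) trivial#rest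

  paths-unique : ∀ k u v → Unique (paths k u v)
  paths-unique zero    u v = []
  paths-unique (suc k)     = extend-unique (paths-sound k) (paths-unique k)


module Recurrence {c ℓ : Level} (R : CommutativeRing c ℓ) (B : Over.SBP R) where
  open Over R
  open SBP B
  open PolyAlgebra R
  open ≈P-Reasoning
  open TermSemantics R
  open SBPPaths R B
  open PathEnumeration R B
  open CommutativeRing R using (0#; 1#) renaming (Carrier to F)

  labelsWeight : List Label → Poly
  labelsWeight = foldr (λ l acc → weightPoly (proj₁ l) ⊗ acc) (con 1#)

  labelsWeight-++ : ∀ ls ls′ → labelsWeight (ls ++ ls′) ≈P labelsWeight ls ⊗ labelsWeight ls′
  labelsWeight-++ []       ls′ = sym≈ (⊗-idˡ _)
  labelsWeight-++ (l ∷ ls) ls′ = trans≈ (⊗-cong refl≈ (labelsWeight-++ ls ls′)) (sym≈ (⊗-assoc _ _ _))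

  weightOf-hop : ∀ {u u′ t l} → edge u u′ ≡ just l → weightOf B (u ∷ u′ ∷ t) ≡ weightPoly (proj₁ l) ⊗ weightOf B (u′ ∷ t)
  weightOf-hop e = cong labelsWeight (labelsFrom-hop e)

  weightOf-bracket : ∀ {u u′ tp x y tq w₁ w₂ o₁ o₂} → edge u u′ ≡ just (w₁ , o₁) → Path u′ tp x →
                     edge x y ≡ just (w₂ , o₂) →
                     weightOf B (u ∷ (u′ ∷ tp) ++ (y ∷ tq))
                       ≈P weightPoly w₁ ⊗ (weightOf B (u′ ∷ tp) ⊗ (weightPoly w₂ ⊗ weightOf B (y ∷ tq)))
  weightOf-bracket {u} {u′} {tp} {x} {y} {tq} {w₁} e₁ p e₂ = begin
    weightOf B (u ∷ u′ ∷ tp ++ y ∷ tq)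
      ≡⟨ weightOf-hop {t = tp ++ y ∷ tq} e₁ ⟩
    weightPoly w₁ ⊗ labelsWeight (labelsFrom B u′ (tp ++ y ∷ tq))
      ≡⟨ cong (λ ls → weightPoly w₁ ⊗ labelsWeight ls) (labelsFrom-++ (y ∷ tq) p) ⟩
    weightPoly w₁ ⊗ labelsWeight (labelsFrom B u′ tp ++ labelsFrom B x (y ∷ tq))
      ≈⟨ ⊗-cong refl≈ (labelsWeight-++ (labelsFrom B u′ tp) _) ⟩
    weightPoly w₁ ⊗ (labelsWeight (labelsFrom B u′ tp) ⊗ labelsWeight (labelsFrom B x (y ∷ tq)))
      ≡⟨ cong (λ ls → weightPoly w₁ ⊗ (labelsWeight (labelsFrom B u′ tp) ⊗ labelsWeight ls)) (labelsFrom-hop e₂) ⟩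
    weightPoly w₁ ⊗ (weightOf B (u′ ∷ tp) ⊗ (_ ⊗ weightOf B (y ∷ tq))) ∎

  -- Holes of the templates: the path sums of the previous level, one per pair of endpoints.
  Hole : Set
  Hole = V × V

  pathSum : PathTable → Hole → Poly
  pathSum P (u , v) = sumOf (weightOf B) (P u v)

  weightTerm : Weight → Term F Hole
  weightTerm (wConst a) = tcon a
  weightTerm (wVar x)   = tvar x

  ⟦weightTerm⟧ : ∀ w ρ → ⟦ weightTerm w ⟧ ρ ≡ weightPoly w
  ⟦weightTerm⟧ (wConst a) ρ = refl
  ⟦weightTerm⟧ (wVar x)   ρ = refl

  -- the trivial path has the empty product 1 as weight
  trivialTerm : V → V → Term F Hole
  trivialTerm u v with u ≟ v
  ... | yes _ = tcon 1# ⊕ᵗ tcon 0#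
  ... | no  _ = tcon 0#

  nopTerm : Maybe Weight → Term F Hole → Term F Hole
  nopTerm (just w) t = weightTerm w ⊗ᵗ t
  nopTerm nothing  t = tcon 0#

  bracketTerm : Maybe (Weight × Weight) → Term F Hole → Term F Hole → Term F Hole
  bracketTerm (just (w₁ , w₂)) s t = weightTerm w₁ ⊗ᵗ (s ⊗ᵗ (weightTerm w₂ ⊗ᵗ t))
  bracketTerm nothing          s t = tcon 0#

  nopSummand : V → V → V → Term F Hole
  nopSummand u v u′ = nopTerm (nopWeight (edge u u′)) (hole (u′ , v))

  bracketSummand : V → V → V × V × V → Term F Hole
  bracketSummand u v (u′ , x , y) = bracketTerm (bracketWeights (edge u u′) (edge x y)) (hole (u′ , x)) (hole (y , v))

  template : V → V → Term F Hole
  template u v = trivialTerm u v ⊕ᵗ (Σᵗ vertices (nopSummand u v) ⊕ᵗ Σᵗ triples (bracketSummand u v))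

  module _ {P : PathTable} (sound : Sound P) where

    trivial-sum : ∀ u v → sumOf (weightOf B) (trivial u v) ≈P ⟦ trivialTerm u v ⟧ (pathSum P)
    trivial-sum u v with u ≟ v
    ... | yes _ = refl≈
    ... | no  _ = refl≈

    nopStep-sum : ∀ u v u′ → sumOf (weightOf B) (nopStep P u v u′) ≈P ⟦ nopSummand u v u′ ⟧ (pathSum P)
    nopStep-sum u v u′ with nopWeight (edge u u′) in eq
    ... | nothing = refl≈
    ... | just w  = begin
      sumOf (weightOf B) (map (u ∷_) (P u′ v))             ≡⟨ sumOf-map (weightOf B) (u ∷_) (P u′ v) ⟩
      sumOf (λ p → weightOf B (u ∷ p)) (P u′ v)            ≈⟨ sumOf-cong (P u′ v) first-hop ⟩
      sumOf (λ p → weightPoly w ⊗ weightOf B p) (P u′ v)   ≈⟨ sumOf-scaleˡ (weightOf B) (weightPoly w) (P u′ v) ⟩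
      weightPoly w ⊗ pathSum P (u′ , v)                    ≡⟨ cong (_⊗ pathSum P (u′ , v)) (sym (⟦weightTerm⟧ w (pathSum P))) ⟩
      ⟦ weightTerm w ⟧ (pathSum P) ⊗ pathSum P (u′ , v)    ∎
      where
        first-hop : ∀ p → p ∈ P u′ v → weightOf B (u ∷ p) ≈P weightPoly w ⊗ weightOf B p
        first-hop p p∈ with sound p∈
        ... | canonical t refl _ _ = ≡⇒≈P (weightOf-hop {t = t} (nopWeight-inv (edge u u′) eq))

    bracketStep-sum : ∀ u v u′ x y →
      sumOf (weightOf B) (bracketStep P u v (u′ , x , y)) ≈P ⟦ bracketSummand u v (u′ , x , y) ⟧ (pathSum P)
    bracketStep-sum u v u′ x y with bracketWeights (edge u u′) (edge x y) in eq
    ... | nothing         = refl≈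
    ... | just (w₁ , w₂) with bracketWeights-inv (edge u u′) (edge x y) eq
    ... | s , e₁ , e₂ = begin
      sumOf wt (joins u Ps Qs)                               ≈⟨ sumOf-concatMap wt (λ p → map (λ q → u ∷ p ++ q) Qs) Ps ⟩
      sumOf (λ p → sumOf wt (map (λ q → u ∷ p ++ q) Qs)) Ps ≈⟨ sumOf-cong Ps inner ⟩
      sumOf (λ p → W₁ ⊗ (wt p ⊗ K)) Ps                      ≈⟨ sumOf-scaleˡ (λ p → wt p ⊗ K) W₁ Ps ⟩
      W₁ ⊗ sumOf (λ p → wt p ⊗ K) Ps                        ≈⟨ ⊗-cong refl≈ (sumOf-scaleʳ wt K Ps) ⟩
      W₁ ⊗ (sumOf wt Ps ⊗ K)                                 ≡⟨ cong₂ (λ a b → a ⊗ (sumOf wt Ps ⊗ (b ⊗ sumOf wt Qs)))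
                                                                  (sym (⟦weightTerm⟧ w₁ (pathSum P))) (sym (⟦weightTerm⟧ w₂ (pathSum P))) ⟩
      ⟦ weightTerm w₁ ⟧ (pathSum P) ⊗ (sumOf wt Ps ⊗ (⟦ weightTerm w₂ ⟧ (pathSum P) ⊗ sumOf wt Qs)) ∎
      where
        wt = weightOf B
        Ps = P u′ x
        Qs = P y v
        W₁ = weightPoly w₁
        W₂ = weightPoly w₂
        K  = W₂ ⊗ sumOf wt Qs
        split : ∀ {p q} → p ∈ Ps → q ∈ Qs → wt (u ∷ p ++ q) ≈P W₁ ⊗ (wt p ⊗ (W₂ ⊗ wt q))
        split p∈ q∈ with sound p∈ | sound q∈
        ... | canonical _ refl path _ | canonical _ refl _ _ = weightOf-bracket e₁ path e₂
        inner : ∀ p → p ∈ Ps → sumOf wt (map (λ q → u ∷ p ++ q) Qs) ≈P W₁ ⊗ (wt p ⊗ K)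
        inner p p∈ = begin
          sumOf wt (map (λ q → u ∷ p ++ q) Qs)           ≡⟨ sumOf-map wt (λ q → u ∷ p ++ q) Qs ⟩
          sumOf (λ q → wt (u ∷ p ++ q)) Qs               ≈⟨ sumOf-cong Qs (λ q q∈ → split p∈ q∈) ⟩
          sumOf (λ q → W₁ ⊗ (wt p ⊗ (W₂ ⊗ wt q))) Qs     ≈⟨ sumOf-scaleˡ (λ q → wt p ⊗ (W₂ ⊗ wt q)) W₁ Qs ⟩
          W₁ ⊗ sumOf (λ q → wt p ⊗ (W₂ ⊗ wt q)) Qs       ≈⟨ ⊗-cong refl≈ (sumOf-scaleˡ (λ q → W₂ ⊗ wt q) (wt p) Qs) ⟩
          W₁ ⊗ (wt p ⊗ sumOf (λ q → W₂ ⊗ wt q) Qs)       ≈⟨ ⊗-cong refl≈ (⊗-cong refl≈ (sumOf-scaleˡ wt W₂ Qs)) ⟩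
          W₁ ⊗ (wt p ⊗ K)                                 ∎

    extend-sum : ∀ u v → pathSum (extend P) (u , v) ≈P ⟦ template u v ⟧ (pathSum P)
    extend-sum u v = begin
      sumOf wt (trivial u v ++ (nops ++ brackets))
        ≈⟨ sumOf-++ wt (trivial u v) _ ⟩
      sumOf wt (trivial u v) ⊕ sumOf wt (nops ++ brackets)
        ≈⟨ ⊕-cong (trivial-sum u v) (sumOf-++ wt nops brackets) ⟩
      ⟦ trivialTerm u v ⟧ ρ ⊕ (sumOf wt nops ⊕ sumOf wt brackets)
        ≈⟨ ⊕-cong refl≈ (⊕-cong (sum-over vertices (nopStep P u v) (nopSummand u v) (nopStep-sum u v))
                                 (sum-over triples (bracketStep P u v) (bracketSummand u v)
                                           (λ { (u′ , x , y) → bracketStep-sum u v u′ x y }))) ⟩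
      ⟦ template u v ⟧ ρ ∎
      where
        wt = weightOf B
        ρ = pathSum P
        nops = concatMap (nopStep P u v) vertices
        brackets = concatMap (bracketStep P u v) triples
        sum-over : ∀ {A : Set} (xs : List A) (f : A → List (List V)) (t : A → Term F Hole) →
                   (∀ a → sumOf wt (f a) ≈P ⟦ t a ⟧ ρ) → sumOf wt (concatMap f xs) ≈P ⟦ Σᵗ xs t ⟧ ρ
        sum-over xs f t f≈t = trans≈ (sumOf-concatMap wt f xs)
                                (trans≈ (sumOf-cong xs (λ a _ → f≈t a)) (≡⇒≈P (sym (⟦Σᵗ⟧ xs t ρ))))


-- The size of the templates (cubic in the number of vertices n) and of the whole
-- circuit (n levels of n² templates on top of one constant gate).
templateSize : ℕ → ℕ
templateSize n = n * (n * n) * 8 + n * 4 + 17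

circuitSize : ℕ → ℕ
circuitSize n = suc (n * ((n * n) * templateSize n))

circuitSize-growth : ∀ {s} → PolyGrowth s → PolyGrowth (λ x → circuitSize (s x))
circuitSize-growth |V| =
  growth-suc (growth-* |V| (growth-* (growth-* |V| |V|)
    (growth-+ (growth-+ (growth-* (growth-* |V| (growth-* |V| |V|)) (growth-const 8)) (growth-* |V| (growth-const 4)))
              (growth-const 17))))

module TemplateSize {c ℓ : Level} (R : CommutativeRing c ℓ) (B : Over.SBP R) where
  open Over R
  open SBP B
  open TermSemantics R
  open PathEnumeration R B
  open Recurrence R B
  open ≤-Reasoning
  open +-*-Solver using (solve; _:+_; _:*_; _:=_; con)

  length-vertices : length vertices ≡ size
  length-vertices = length-tabulate (λ v → v)

  length-triples : length triples ≡ size * (size * size)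
  length-triples = trans (length-cartesianProduct vertices _)
                     (cong₂ _*_ length-vertices
                       (trans (length-cartesianProduct vertices vertices) (cong₂ _*_ length-vertices length-vertices)))

  template-size : ∀ u v → tsize (template u v) ≤ templateSize size
  template-size u v = begin
    tsize (template u v)
      ≤⟨ s≤s (+-mono-≤ (trivial-size u v) (s≤s (+-mono-≤
           (tsize-Σᵗ vertices (nopSummand u v) (λ u′ → nop-size (nopWeight (edge u u′))))
           (tsize-Σᵗ triples (bracketSummand u v) (λ { (u′ , x , y) → bracket-size (bracketWeights (edge u u′) (edge x y)) }))))) ⟩
    suc (3 + suc (suc (length vertices) * 4 + suc (length triples) * 8))
      ≡⟨ cong₂ (λ m m³ → suc (3 + suc (suc m * 4 + suc m³ * 8))) length-vertices length-triples ⟩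
    suc (3 + suc (suc size * 4 + suc (size * (size * size)) * 8))
      ≡⟨ solve 1 (λ n → con 1 :+ (con 3 :+ (con 1 :+ ((con 1 :+ n) :* con 4 :+ (con 1 :+ n :* (n :* n)) :* con 8)))
                         := n :* (n :* n) :* con 8 :+ n :* con 4 :+ con 17) refl size ⟩
    templateSize size ∎
    where
      weight-size : ∀ w → tsize (weightTerm w) ≡ 1
      weight-size (wConst _) = refl
      weight-size (wVar _)   = refl
      trivial-size : ∀ u v → tsize (trivialTerm u v) ≤ 3
      trivial-size u v with u ≟ v
      ... | yes _ = ≤-refl
      ... | no  _ = s≤s z≤n
      nop-size : ∀ m {h} → tsize (nopTerm m (hole h)) ≤ 3
      nop-size (just w) rewrite weight-size w = ≤-refl
      nop-size nothing  = s≤s z≤n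
      bracket-size : ∀ m {h h′} → tsize (bracketTerm m (hole h) (hole h′)) ≤ 7
      bracket-size (just (w₁ , w₂)) rewrite weight-size w₁ | weight-size w₂ = ≤-refl
      bracket-size nothing           = s≤s z≤n


-- Circuits.  Gates are appended at the end, so old gates keep their values.
lookup-∷ʳ-inject₁ : ∀ {a} {A : Set a} {n} (vs : Vec A n) x (f : Fin n) → lookup (vs ∷ʳ x) (inject₁ f) ≡ lookup vs f
lookup-∷ʳ-inject₁ (v ∷ vs) x zero    = refl
lookup-∷ʳ-inject₁ (v ∷ vs) x (suc f) = lookup-∷ʳ-inject₁ vs x f

lookup-∷ʳ-last : ∀ {a} {A : Set a} {n} (vs : Vec A n) x → lookup (vs ∷ʳ x) (fromℕ n) ≡ x
lookup-∷ʳ-last []       x = refl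
lookup-∷ʳ-last (v ∷ vs) x = lookup-∷ʳ-last vs x

binary-bound : ∀ {i j₁ j₂ a b} → j₁ ≤ i + a → j₂ ≤ j₁ + b → suc j₂ ≤ i + suc (a + b)
binary-bound {i} {j₁} {j₂} {a} {b} bound₁ bound₂ = begin
  suc j₂            ≤⟨ s≤s (≤-trans bound₂ (+-monoˡ-≤ b bound₁)) ⟩
  suc (i + a + b)   ≡⟨ cong suc (+-assoc i a b) ⟩
  suc (i + (a + b)) ≡⟨ sym (+-suc i (a + b)) ⟩
  i + suc (a + b)   ∎
  where open Data.Nat.Properties.≤-Reasoning

layer-bound : ∀ {i j₁ j₂ m M t} → j₁ ≤ i + m * M → j₂ ≤ j₁ + t → t ≤ M → j₂ ≤ i + suc m * M
layer-bound {i} {j₁} {j₂} {m} {M} {t} bound₁ bound₂ t≤M = begin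
  j₂              ≤⟨ ≤-trans bound₂ (+-mono-≤ bound₁ t≤M) ⟩
  i + m * M + M   ≡⟨ +-assoc i (m * M) M ⟩
  i + (m * M + M) ≡⟨ cong (i +_) (+-comm (m * M) M) ⟩
  i + suc m * M   ∎
  where open Data.Nat.Properties.≤-Reasoning

module CircuitBuilding {c ℓ : Level} (R : CommutativeRing c ℓ) where
  open Over R
  open PolyAlgebra R
  open TermSemantics R
  open CommutativeRing R using () renaming (Carrier to F)

  record _⊑_ {i j} (g : Gates i) (g′ : Gates j) : Set c where
    constructor embedding
    field
      embed      : Fin i → Fin j
      embed-eval : ∀ f → lookup (evalGates g′) (embed f) ≡ lookup (evalGates g) f

  ⊑-refl : ∀ {i} {g : Gates i} → g ⊑ g
  ⊑-refl = embedding (λ f → f) (λ f → refl)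

  ⊑-trans : ∀ {i j k} {g : Gates i} {g′ : Gates j} {g″ : Gates k} → g ⊑ g′ → g′ ⊑ g″ → g ⊑ g″
  ⊑-trans (embedding e e-eval) (embedding e′ e′-eval) =
    embedding (λ f → e′ (e f)) (λ f → trans (e′-eval (e f)) (e-eval f))

  ⊑-▷ : ∀ {i} {g : Gates i} (x : Gate i) → g ⊑ (g ▷ x)
  ⊑-▷ {g = g} x = embedding inject₁ (lookup-∷ʳ-inject₁ (evalGates g) _)

  ▷-last : ∀ {i} (g : Gates i) (x : Gate i) → lookup (evalGates (g ▷ x)) (fromℕ i) ≡ evalGate (evalGates g) x
  ▷-last g x = lookup-∷ʳ-last (evalGates g) _

  record Provides {i} (g : Gates i) (I : Set) (ps : I → Poly) : Set (c ⊔ ℓ) where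
    constructor provides
    field
      gate      : I → Fin i
      gate-eval : ∀ h → lookup (evalGates g) (gate h) ≈P ps h

  provides-⊑ : ∀ {i j} {g : Gates i} {g′ : Gates j} {I ps} → g ⊑ g′ → Provides g I ps → Provides g′ I ps
  provides-⊑ (embedding e e-eval) (provides gate gate-eval) =
    provides (λ h → e (gate h)) (λ h → trans≈ (≡⇒≈P (e-eval (gate h))) (gate-eval h))

  provides-cong : ∀ {i} {g : Gates i} {I ps qs} → (∀ h → ps h ≈P qs h) → Provides g I ps → Provides g I qs
  provides-cong ps≈qs (provides gate gate-eval) = provides gate (λ h → trans≈ (gate-eval h) (ps≈qs h))

  provides-reindex : ∀ {i} {g : Gates i} {I J} {ps : J → Poly} (to : I → J) (from : J → I) →
                     (∀ j → to (from j) ≡ j) → Provides g I (λ h → ps (to h)) → Provides g J ps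
  provides-reindex {ps = ps} to from to∘from (provides gate gate-eval) =
    provides (λ j → gate (from j)) (λ j → trans≈ (gate-eval (from j)) (≡⇒≈P (cong ps (to∘from j))))

  record Extension {i} (g : Gates i) (J : Set) (qs : J → Poly) (b : ℕ) : Set (c ⊔ ℓ) where
    constructor extended
    field
      {size}   : ℕ
      gates    : Gates size
      extends  : g ⊑ gates
      provided : Provides gates J qs
      bound    : size ≤ i + b

  open Extension

  leaf : ∀ {i} (g : Gates i) (x : Gate i) → Extension g ⊤ (λ _ → evalGate (evalGates g) x) 1
  leaf {i} g x = extended (g ▷ x) (⊑-▷ x) (provides (λ _ → fromℕ i) (λ _ → ≡⇒≈P (▷-last g x)))
                          (≤-reflexive (+-comm 1 i))

  binary : ∀ {i} {g : Gates i} {p q a b} (op : ∀ {j} → Fin j → Fin j → Gate j) (_∙_ : Poly → Poly → Poly) →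
           (∀ {j} (vs : Vec Poly j) f f′ → evalGate vs (op f f′) ≡ lookup vs f ∙ lookup vs f′) →
           (∀ {p p′ q q′} → p ≈P p′ → q ≈P q′ → (p ∙ q) ≈P (p′ ∙ q′)) →
           (E₁ : Extension g ⊤ (λ _ → p) a) → Extension (gates E₁) ⊤ (λ _ → q) b →
           Extension g ⊤ (λ _ → p ∙ q) (suc (a + b))
  binary {i} {a = a} {b} op _∙_ op-eval ∙-cong
         (extended {j₁} g₁ ext₁ (provides out₁ out₁-eval) bound₁)
         (extended {j₂} g₂ ext₂ (provides out₂ out₂-eval) bound₂) =
    extended (g₂ ▷ op (embed ext₂ (out₁ _)) (out₂ _)) (⊑-trans (⊑-trans ext₁ ext₂) (⊑-▷ _))
             (provides (λ _ → fromℕ j₂) (λ _ → trans≈ (≡⇒≈P (trans (▷-last g₂ _) (op-eval (evalGates g₂) _ _)))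
                                                       (∙-cong (trans≈ (≡⇒≈P (embed-eval ext₂ (out₁ _))) (out₁-eval _))
                                                               (out₂-eval _))))
             (binary-bound bound₁ bound₂)
    where open _⊑_

  compile : ∀ {i} (g : Gates i) {I ps} → Provides g I ps → (t : Term F I) → Extension g ⊤ (λ _ → ⟦ t ⟧ ps) (tsize t)
  compile {i} g (provides gate gate-eval) (hole h) =
    extended g ⊑-refl (provides (λ _ → gate h) (λ _ → gate-eval h)) (m≤m+n i 1)
  compile g H (tcon a) = leaf g (inConst a)
  compile g H (tvar x) = leaf g (inVar x)
  compile g H (s ⊕ᵗ t) =
    let E = compile g H s in binary add _⊕_ (λ _ _ _ → refl) ⊕-cong E (compile (gates E) (provides-⊑ (extends E) H) t)
  compile g H (s ⊗ᵗ t) =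
    let E = compile g H s in binary mul _⊗_ (λ _ _ _ → refl) ⊗-cong E (compile (gates E) (provides-⊑ (extends E) H) t)

  layer : ∀ m {i} (g : Gates i) {I ps} → Provides g I ps → (ts : Fin m → Term F I) → ∀ {M} →
          (∀ j → tsize (ts j) ≤ M) → Extension g (Fin m) (λ j → ⟦ ts j ⟧ ps) (m * M)
  layer zero {i} g H ts _ = extended g ⊑-refl (provides (λ ()) (λ ())) (≤-reflexive (sym (+-identityʳ i)))
  layer (suc m) {i} g H ts ts≤M with layer m g H (λ j → ts (suc j)) (λ j → ts≤M (suc j))
  ... | extended g₁ ext₁ (provides gate₁ gate₁-eval) bound₁
    with compile g₁ (provides-⊑ ext₁ H) (ts zero)
  ... | extended g₂ ext₂ (provides out out-eval) bound₂ =
    extended g₂ (⊑-trans ext₁ ext₂) (provides gate gate-eval) (layer-bound {i} {m = m} bound₁ bound₂ (ts≤M zero))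
    where
      open _⊑_ ext₂
      gate : Fin (suc m) → Fin _
      gate zero    = out _
      gate (suc j) = embed (gate₁ j)
      gate-eval : ∀ j → lookup (evalGates g₂) (gate j) ≈P ⟦ ts j ⟧ _
      gate-eval zero    = out-eval _
      gate-eval (suc j) = trans≈ (≡⇒≈P (embed-eval (gate₁ j))) (gate₁-eval j)

  squareLayer : ∀ n {i} (g : Gates i) {I ps} → Provides g I ps → (ts : Fin n × Fin n → Term F I) → ∀ {M} →
                (∀ j → tsize (ts j) ≤ M) → Extension g (Fin n × Fin n) (λ j → ⟦ ts j ⟧ ps) ((n * n) * M)
  squareLayer n g H ts ts≤M with layer (n * n) g H (λ k → ts (remQuot n k)) (λ k → ts≤M (remQuot n k))
  ... | extended g′ ext H′ bound =
    extended g′ ext (provides-reindex (remQuot n) (uncurry combine) (uncurry remQuot-combine) H′) bound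


next-level-bound : ∀ {j j′ k L} → j ≤ suc (k * L) → j′ ≤ j + L → j′ ≤ suc (suc k * L)
next-level-bound {j} {j′} {k} {L} bound bound′ =
  ≤-trans bound′ (≤-trans (+-mono-≤ bound ≤-refl) (≤-reflexive (cong suc (+-comm (k * L) L))))

module FromSBP {c ℓ : Level} (R : CommutativeRing c ℓ) (B : Over.SBP R) where
  open Over R
  open SBP B
  open PolyAlgebra R
  open SBPPaths R B
  open PathEnumeration R B
  open Recurrence R B
  open TemplateSize R B
  open CircuitBuilding R
  open StackWords R symbols
  open TermSemantics R
  open CommutativeRing R using (0#)

  levelSize : ℕ
  levelSize = (size * size) * templateSize size

  nextLevel : ∀ k → Extension [] Hole (pathSum (paths k)) (suc (k * levelSize)) →
              Extension [] Hole (pathSum (paths (suc k))) (suc (suc k * levelSize))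
  nextLevel k (extended g ext H bound) = grow (squareLayer size g H (uncurry template) (uncurry template-size))
    where
      grow : Extension g Hole (λ h → ⟦ uncurry template h ⟧ (pathSum (paths k))) levelSize →
             Extension [] Hole (pathSum (paths (suc k))) (suc (suc k * levelSize))
      grow (extended g′ ext′ H′ bound′) =
        extended g′ (⊑-trans ext ext′) (provides-cong (uncurry (λ u v → sym≈ (extend-sum (paths-sound k) u v))) H′)
                 (next-level-bound {k = k} {L = levelSize} bound bound′)

  levels : ∀ k → Extension [] Hole (pathSum (paths k)) (suc (k * levelSize))
  levels zero    = extended ([] ▷ inConst 0#) (⊑-▷ _) (provides (λ _ → zero) (λ _ → refl≈)) ≤-refl
  levels (suc k) = nextLevel k (levels k)

  isPath⇒Path : ∀ {u p} → IsPathFrom B u p → ∃ λ t → p ≡ u ∷ t × Path u t target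
  isPath⇒Path here = [] , refl , stop
  isPath⇒Path (step l e rest) with isPath⇒Path rest
  ... | t , refl , path = _ , refl , hop l e path

  Path⇒isPath : ∀ {u t} → Path u t target → IsPathFrom B u (u ∷ t)
  Path⇒isPath stop         = here
  Path⇒isPath (hop l e p) = step l e (Path⇒isPath p)

  -- Acyclicity: vertex numbers increase along a path, so a path has fewer
  -- edges than there are vertices.
  path-climbs : ∀ {u t v} → Path u t v → length t + toℕ u ≤ toℕ v
  path-climbs stop = ≤-refl
  path-climbs {u} (hop {u′ = u′} {t} l e p) =
    ≤-trans (≤-reflexive (sym (+-suc (length t) (toℕ u)))) (≤-trans (+-monoʳ-≤ (length t) (acyclic u u′ l e)) (path-climbs p))

  path-short : ∀ {u t v} → Path u t v → length t < size
  path-short {u} {t} {v} p = ≤-<-trans (≤-trans (m≤m+n (length t) (toℕ u)) (path-climbs p)) (toℕ<n v)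

  goodPath⇔ : ∀ p → (p ∈ paths size source target) ⇔ GoodPath B p
  goodPath⇔ p = mk⇔ to from
    where
      to : p ∈ paths size source target → GoodPath B p
      to p∈ with paths-sound size p∈
      ... | canonical t refl path b = Path⇒isPath path , balanced⇒realizable b
      from : GoodPath B p → p ∈ paths size source target
      from (isPath , r) with isPath⇒Path isPath
      ... | t , refl , path = paths-complete size path (realizable⇒balanced r) (path-short path)

  enumeration-sum : ∀ L → Unique L → (∀ p → (p ∈ L) ⇔ GoodPath B p) →
                    sumOf (weightOf B) L ≈P pathSum (paths size) (source , target)
  enumeration-sum L L! L⇔ = sumOf-↭ (weightOf B) (∼bag⇒↭ (unique∧set⇒bag L! (paths-unique size source target)
    (λ {p} → mk⇔ (λ p∈ → Equivalence.from (goodPath⇔ p) (Equivalence.to (L⇔ p) p∈))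
                 (λ p∈ → Equivalence.from (L⇔ p) (Equivalence.to (goodPath⇔ p) p∈)))))

  -- Degree: every good path has fewer than |V| edges, each of weight degree ≤ 1.
  sdeg-sumOf : ∀ {a} {A : Set a} (f : A → Poly) d xs → (∀ x → x ∈ xs → sdeg (f x) ≤ d) → sdeg (sumOf f xs) ≤ d
  sdeg-sumOf f d []       _     = z≤n
  sdeg-sumOf f d (x ∷ xs) f≤d = ⊔-lub (f≤d x (here refl)) (sdeg-sumOf f d xs (λ y y∈ → f≤d y (there y∈)))

  sdeg-labelsWeight : ∀ ls → sdeg (labelsWeight ls) ≤ length ls
  sdeg-labelsWeight []                   = z≤n
  sdeg-labelsWeight ((wConst _ , _) ∷ ls) = ≤-trans (sdeg-labelsWeight ls) (n≤1+n _)
  sdeg-labelsWeight ((wVar _ , _) ∷ ls)   = s≤s (sdeg-labelsWeight ls)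

  enumeration-degree : ∀ L → (∀ p → (p ∈ L) ⇔ GoodPath B p) → sdeg (sumOf (weightOf B) L) ≤ size
  enumeration-degree L L⇔ = sdeg-sumOf (weightOf B) size L good-degree
    where
      good-degree : ∀ p → p ∈ L → sdeg (weightOf B p) ≤ size
      good-degree p p∈ with isPath⇒Path (proj₁ (Equivalence.to (L⇔ p) p∈))
      ... | t , refl , path = ≤-trans (sdeg-labelsWeight (labelsFrom B source t))
            (≤-trans (≤-reflexive (trans (sym (length-map proj₂ (labelsFrom B source t))) (opsFrom-length path)))
                     (<⇒≤ (path-short path)))

  allLevels : Extension [] Hole (pathSum (paths size)) (suc (size * levelSize))
  allLevels = levels size

  circuit : Circuit
  circuit = record { size   = Extension.size allLevels
                   ; gates  = Extension.gates allLevels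
                   ; output = Provides.gate (Extension.provided allLevels) (source , target) }

  circuit-size : Circuit.size circuit ≤ circuitSize size
  circuit-size = Extension.bound allLevels

  circuit-correct : ∀ {f} → SBPComputes B f → CircuitComputes circuit f
  circuit-correct (L , L! , L⇔ , sum≈f) =
    trans≈ (Provides.gate-eval (Extension.provided allLevels) (source , target))
           (trans≈ (sym≈ (enumeration-sum L L! L⇔)) sum≈f)

  degree-bound : ∀ {f} → SBPComputes B f → DegreeAtMost f size
  degree-bound (L , _ , L⇔ , sum≈f) = sumOf (weightOf B) L , sum≈f , enumeration-degree L L⇔


lemma10 : {c ℓ : Level} (F : CommutativeRing c ℓ) → IsField F →
          (f : ℕ → Over.Poly F) →
          Over.ComputedByPolySBPs F f → Over.InVP F f
lemma10 F _ f (B , sizes-bounded , computes) =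
    ((λ n → SBP.size (B n)) , sizes-bounded , (λ n → degree-bound (B n) (computes n)))
  , (circuit ∘ B , circuits-bounded , (λ n → circuit-correct (B n) (computes n)))
  where
    open Over F using (SBP; Circuit; PolyBounded)
    open FromSBP F using (circuit; circuit-size; circuit-correct; degree-bound)

    circuits-bounded : PolyBounded (λ n → Circuit.size (circuit (B n)))
    circuits-bounded = growth⇒polyBounded (growth-≤ (λ n → circuit-size (B n))
                         (circuitSize-growth (polyBounded⇒growth sizes-bounded)))
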